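{- There is a deterministic algorithm for the Search on Trees problem which, when given a tree $T=(V,E)$ of pathwidth $k$ and a prediction $s\in V$, finds the unknown target $t\in V$ using at most $O(k\log \mathrm{dist}(s,t))$ queries.
   Context: Search on Trees problem: we are given a finite tree $T=(V,E)$ and a prediction $s\in V$; there is an unknown target node $t\in V$. The algorithm may adaptively query any node $x\in V$; the query returns "here" if $x=t$, and otherwise returns the unique neighbor of $x$ lying on the path in $T$ from $x$ to $t$. The goal is to find $t$. $\mathrm{dist}(s,t)$ is the number of edges on the path in $T$ between $s$ and $t$. Pathwidth: a path decomposition of a graph $G$ is a sequence of vertex sets $B_1,\dots,B_m$ whose union is $V(G)$, such that every edge has both endpoints in some $B_i$, and for every vertex $v$ the set $\{i: v\in B_i\}$ is an interval; its width is $\max_i|B_i|-1$, and the pathwidth of $G$ is the minimum width of a path decomposition. -}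

module Defs where

open import Data.Nat using (ℕ; zero; suc; _≤_; _+_)
open import Data.Bool using (Bool; true)
open import Data.Fin using (Fin)
open import Data.Fin.Subset using (Subset; _∈_; ∣_∣)
open import Data.List using (List; []; _∷_; head; last; length)
open import Data.List.Relation.Unary.Linked using (Linked)
open import Data.List.Relation.Unary.Unique.Propositional using (Unique)
open import Data.Maybe using (Maybe; just)
open import Data.Product using (Σ; _×_; ∃)
open import Relation.Binary.PropositionalEquality using (_≡_; _≢_)
open import Relation.Nullary using (¬_)

-- A finite simple graph on vertex set Fin n, given by a Boolean adjacency matrix
-- (so that an algorithm can inspect it).
Graph : ℕ → Set
Graph n = Fin n → Fin n → Bool

Adj : ∀ {n} → Graph n → Fin n → Fin n → Set
Adj G u v = G u v ≡ true

IsPath : ∀ {n} → Graph n → Fin n → Fin n → List (Fin n) → Set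
IsPath G u v p = Linked (Adj G) p × Unique p × head p ≡ just u × last p ≡ just v

IsCycle : ∀ {n} → Graph n → List (Fin n) → Set
IsCycle {n} G p = 3 ≤ length p × Linked (Adj G) p × Unique p
  × Σ (Fin n) λ a → Σ (Fin n) λ b → head p ≡ just a × last p ≡ just b × Adj G b a

record IsTree {n : ℕ} (G : Graph n) : Set where
  field
    symmetric   : ∀ u v → Adj G u v → Adj G v u
    irreflexive : ∀ u → ¬ Adj G u u
    connected   : ∀ u v → ∃ λ p → IsPath G u v p
    acyclic     : ∀ p → ¬ IsCycle G p

-- dist(u,v) = d : the (unique, in a tree) path from u to v has d edges.
Dist : ∀ {n} → Graph n → Fin n → Fin n → ℕ → Set
Dist G u v d = ∃ λ p → IsPath G u v p × length p ≡ suc d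

record PathDecomposition {n : ℕ} (G : Graph n) (w : ℕ) : Set where
  field
    m        : ℕ
    bag      : Fin m → Subset n
    covers   : ∀ v → Σ (Fin m) λ i → v ∈ bag i
    edges    : ∀ u v → Adj G u v → Σ (Fin m) λ i → u ∈ bag i × v ∈ bag i
    interval : ∀ (v : Fin n) (i j l : Fin m) → i Data.Fin.≤ j → j Data.Fin.≤ l →
               v ∈ bag i → v ∈ bag l → v ∈ bag j
    width≤   : ∀ i → ∣ bag i ∣ ≤ suc w

Pathwidth : ∀ {n} → Graph n → ℕ → Set
Pathwidth G k = PathDecomposition G k × (∀ w → PathDecomposition G w → k ≤ w)

data Response (n : ℕ) : Set where
  here   : Response n
  toward : Fin n → Response n

data ValidAnswer {n : ℕ} (G : Graph n) (t : Fin n) : Fin n → Response n → Set where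
  found : ValidAnswer G t t here
  step  : ∀ {x y} → x ≢ t → (∃ λ rest → IsPath G x t (x ∷ y ∷ rest)) →
          ValidAnswer G t x (toward y)

data Strategy (n : ℕ) : Set where
  done  : Fin n → Strategy n
  query : Fin n → (Response n → Strategy n) → Strategy n

data FindsWithin {n : ℕ} (G : Graph n) (t : Fin n) : Strategy n → ℕ → Set where
  done  : ∀ {q} → FindsWithin G t (done t) q
  query : ∀ {x f q} → (∀ r → ValidAnswer G t x r → FindsWithin G t (f r) q) →
          FindsWithin G t (query x f) (suc q)

{-# OPTIONS --safe #-}
-- Fix an optimal path decomposition. The level-j strategy keeps the current vertex w and the
-- target t inside a subtree R meeting every bag in at most j + 1 vertices. With u in the first
-- and v in the last bag meeting R, the path from u to v meets every bag that meets R. Two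
-- galloping searches (doubling, then bisection), along the path from w to u and then from the
-- exit point x₁ to v, find where the way to t leaves these paths with O(log dist(w, t)) queries
-- each; the answer at the second exit point leads into the part of R that avoids both paths,
-- where every nonempty bag has lost a vertex of the path from u to v. After k such rounds R is
-- a single vertex, so k (6 + 4 log d) queries suffice.
-- The algorithm is given neither k nor a decomposition: it searches all strategies of bounded
-- depth for one with the best guarantee R (1 + log d), and the level strategy bounds this R by
-- 6 (k + 1).
module Submission where

open import Defs
open import Data.Bool using (true)
import Data.Bool.Properties as Bool
open import Data.Empty using (⊥; ⊥-elim)
open import Data.Fin as Fin using (Fin)
open import Data.Fin.Properties as Fin using (_≟_; pigeonhole)
open import Data.Fin.Subset using (Subset; _∩_; ⊤; ⁅_⁆; ∣_∣; Nonempty; Empty)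
  renaming (_∈_ to _∈ₛ_; _∉_ to _∉ₛ_)
open import Data.Fin.Subset.Properties
  using (nonempty?; x∈p∩q⁺; x∈p∩q⁻; p⊂q⇒∣p∣<∣q∣; Empty-unique; ∣⊥∣≡0; ∈⊤; ∣⊤∣≡n; ∣⁅x⁆∣≡1; x∈⁅y⁆⇒x≡y; ∩-identityʳ)
  renaming (_∈?_ to _∈ₛ?_)
open import Data.List as List using (List; []; _∷_; _++_; _∷ʳ_; [_]; head; last; length; reverse)
open import Data.List.Properties
  using (++-assoc; ++-identityʳ; ∷-injectiveʳ; unfold-reverse; reverse-involutive; length-++)
open import Data.List.Membership.Propositional using (_∈_; _∉_)
open import Data.List.Membership.Propositional.Properties
  using (∈-++⁺ˡ; ∈-++⁺ʳ; ∈-++⁻; ∈-∃++; ∈-lookup; ∈-allFin; ∈-map⁺; ∈-concatMap⁺)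
open import Data.List.Relation.Binary.Disjoint.Propositional using (Disjoint)
open import Data.List.Relation.Binary.Subset.Propositional using (_⊆_)
open import Data.List.Relation.Binary.Subset.Propositional.Properties using (⊆-trans; xs⊆ys++xs; xs⊆x∷xs; ∷⁺ʳ; ++⁺ʳ)
open import Data.List.Relation.Unary.All as All using (All; []; _∷_; all?)
open import Data.List.Relation.Unary.All.Properties using (All¬⇒¬Any; ¬Any⇒All¬; ++⁻ˡ; ++⁻ʳ)
open import Data.List.Relation.Unary.Any as Any using (Any; here; there)
open import Data.List.Relation.Unary.Any.Properties using (reverse⁻)
open import Data.List.Relation.Unary.Linked as Linked using (Linked; []; [-]; _∷_; head′; linked?)
open import Data.List.Relation.Unary.Linked.Properties using () renaming (++⁺ to Linked-++⁺)
open import Data.List.Relation.Unary.Unique.Propositional using (Unique; []; _∷_)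
open import Data.List.Relation.Unary.Unique.Propositional.Properties using () renaming (++⁺ to Unique-++⁺)
open import Data.Maybe using (just)
import Data.Maybe.Properties as Maybe
open import Data.Maybe.Relation.Binary.Connected using (Connected; just)
open import Data.Nat as ℕ using (ℕ; zero; suc; pred; _+_; _*_; _^_; _≤_; _<_; s≤s; z≤n; _<?_; _≤?_)
open import Data.Nat.Properties hiding (_≟_)
open import Data.Nat.Logarithm using (⌊log₂_⌋; ⌊log₂⌋-mono-≤; ⌊log₂[2^n]⌋≡n)
open import Data.Nat.Tactic.RingSolver using (solve-∀)
open import Data.Product using (Σ; ∃; ∃₂; _×_; _,_; proj₁; proj₂)
open import Data.Sum using (_⊎_; inj₁; inj₂)
open import Data.Vec as Vec using (Vec)
open import Data.Vec.Properties using (lookup∘tabulate; []=⇒lookup; lookup⇒[]=)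
open import Function using (_∘_; id)
open import Relation.Binary.Definitions using (DecidableEquality; Tri; tri<; tri≈; tri>)
open import Relation.Binary.PropositionalEquality
  using (_≡_; _≢_; refl; sym; trans; cong; cong₂; subst; module ≡-Reasoning)
open import Relation.Nullary using (¬_; Dec; yes; no)
open import Relation.Nullary.Decidable using (does; dec-true; _×-dec_; _→-dec_; ¬?; map′)

-- Lists and finite sets

module _ {A : Set} where

  private variable
    x y z : A
    xs ys zs : List A

  head∉tail : Unique (x ∷ xs) → x ∉ xs
  head∉tail (x∉ ∷ _) = All¬⇒¬Any x∉

  Unique-++⁻ : ∀ xs → Unique (xs ++ ys) → Unique xs × Unique ys × Disjoint xs ys
  Unique-++⁻ [] u = [] , u , λ ()
  Unique-++⁻ (x ∷ xs) (x∉ ∷ u) with Unique-++⁻ xs u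
  ... | uxs , uys , xs#ys = ++⁻ˡ xs x∉ ∷ uxs , uys , λ where
    (here refl , v∈ys) → All¬⇒¬Any (++⁻ʳ xs x∉) v∈ys
    (there v∈xs , v∈ys) → xs#ys (v∈xs , v∈ys)

  last-∈ : last xs ≡ just x → x ∈ xs
  last-∈ {_ ∷ []} refl = here refl
  last-∈ {_ ∷ _ ∷ _} e = there (last-∈ e)

  last-∷ʳ : ∀ xs → last (xs ∷ʳ x) ≡ just x
  last-∷ʳ [] = refl
  last-∷ʳ (_ ∷ []) = refl
  last-∷ʳ (_ ∷ _ ∷ xs) = last-∷ʳ (_ ∷ xs)

  last-++-∷ : ∀ xs → last (xs ++ y ∷ ys) ≡ last (y ∷ ys)
  last-++-∷ [] = refl
  last-++-∷ (_ ∷ []) = refl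
  last-++-∷ (_ ∷ _ ∷ xs) = last-++-∷ (_ ∷ xs)

  last-reverse : ∀ xs → last (reverse xs) ≡ head xs
  last-reverse [] = refl
  last-reverse (x ∷ xs) rewrite unfold-reverse x xs = last-∷ʳ (reverse xs)

  last-glue : last xs ≡ just z → last (z ∷ ys) ≡ just y → last (xs ++ ys) ≡ just y
  last-glue {xs} {ys = []} e refl = trans (cong last (++-identityʳ xs)) e
  last-glue {xs} {ys = _ ∷ _} _ e = trans (last-++-∷ xs) e

  head-++-∷ : ∀ xs → head (xs ++ y ∷ ys) ≡ head (xs ++ y ∷ zs)
  head-++-∷ [] = refl
  head-++-∷ (_ ∷ _) = refl

  head-reverse : ∀ xs → head (reverse xs) ≡ last xs
  head-reverse xs = trans (sym (last-reverse (reverse xs))) (cong last (reverse-involutive xs))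

  Unique-reverse : Unique xs → Unique (reverse xs)
  Unique-reverse {[]} _ = []
  Unique-reverse {x ∷ xs} u@(_ ∷ u′) rewrite unfold-reverse x xs =
    Unique-++⁺ (Unique-reverse u′) ([] ∷ []) λ where
      (v∈ , here refl) → head∉tail u (reverse⁻ v∈)

module _ {A : Set} where

  private variable
    d x y z : A
    xs ys zs : List A
    i j : ℕ

  nth : A → List A → ℕ → A
  nth d [] i = d
  nth d (x ∷ xs) zero = x
  nth d (x ∷ xs) (suc i) = nth d xs i

  nth-++ : ∀ xs → nth d (xs ++ ys) (length xs + i) ≡ nth d ys i
  nth-++ [] = refl
  nth-++ (_ ∷ xs) = nth-++ xs

  head-++-nth : ∀ xs → head (xs ++ y ∷ ys) ≡ just (nth y xs 0)
  head-++-nth [] = refl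
  head-++-nth (_ ∷ _) = refl

  nth-++-∷ : ∀ xs → nth d (xs ++ y ∷ ys) (length xs) ≡ y
  nth-++-∷ [] = refl
  nth-++-∷ (_ ∷ xs) = nth-++-∷ xs

  nth-common-prefix : ∀ xs → i ≤ length xs → nth d (xs ++ y ∷ ys) i ≡ nth d (xs ++ y ∷ zs) i
  nth-common-prefix {zero} [] _ = refl
  nth-common-prefix {zero} (_ ∷ _) _ = refl
  nth-common-prefix {suc i} (_ ∷ xs) (s≤s i≤) = nth-common-prefix xs i≤

  nth-∈ : i < length xs → nth d xs i ∈ xs
  nth-∈ {zero} {_ ∷ _} _ = here refl
  nth-∈ {suc i} {_ ∷ _} (s≤s i<) = there (nth-∈ i<)

  nth-injective : Unique xs → i < length xs → j < length xs → nth d xs i ≡ nth d xs j → i ≡ j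
  nth-injective {i = zero} {j = zero} _ _ _ _ = refl
  nth-injective {_ ∷ _} {i = zero} {j = suc j} u _ (s≤s j<) e =
    ⊥-elim (head∉tail u (subst (_∈ _) (sym e) (nth-∈ j<)))
  nth-injective {_ ∷ _} {i = suc i} {j = zero} u (s≤s i<) _ e =
    ⊥-elim (head∉tail u (subst (_∈ _) e (nth-∈ i<)))
  nth-injective {_ ∷ _} {i = suc i} {j = suc j} (_ ∷ u) (s≤s i<) (s≤s j<) e =
    cong suc (nth-injective u i< j< e)

  record Fork (xs ys : List A) : Set where
    field
      stem : List A
      fork : A
      xs′ ys′ : List A
      xs≡ : xs ≡ stem ++ fork ∷ xs′
      ys≡ : ys ≡ stem ++ fork ∷ ys′
      diverge : head xs′ ≡ just y → head ys′ ≢ just y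

  longestCommonPrefix : DecidableEquality A → ∀ x xs ys → Fork (x ∷ xs) (x ∷ ys)
  longestCommonPrefix _≟_ x (y ∷ xs) (z ∷ ys) with y ≟ z
  ... | yes refl = let open Fork (longestCommonPrefix _≟_ y xs ys) in
    record { stem = x ∷ stem ; fork = fork ; xs′ = xs′ ; ys′ = ys′
           ; xs≡ = cong (x ∷_) xs≡ ; ys≡ = cong (x ∷_) ys≡ ; diverge = diverge }
  ... | no y≢z = record { stem = [] ; fork = x ; xs′ = y ∷ xs ; ys′ = z ∷ ys
                        ; xs≡ = refl ; ys≡ = refl ; diverge = λ { refl refl → y≢z refl } }
  longestCommonPrefix _ x [] ys = record { stem = [] ; fork = x ; xs′ = [] ; ys′ = ys
                                         ; xs≡ = refl ; ys≡ = refl ; diverge = λ () }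
  longestCommonPrefix _ x (y ∷ xs) [] = record { stem = [] ; fork = x ; xs′ = y ∷ xs ; ys′ = []
                                               ; xs≡ = refl ; ys≡ = refl ; diverge = λ _ () }

module _ {A : Set} {R : A → A → Set} where

  private variable
    z : A
    xs ys : List A

  Linked-reverse : (∀ {a b} → R a b → R b a) → Linked R xs → Linked R (reverse xs)
  Linked-reverse R-sym [] = []
  Linked-reverse R-sym [-] = [-]
  Linked-reverse {x ∷ y ∷ xs} R-sym (r ∷ l) rewrite unfold-reverse x (y ∷ xs) =
    Linked-++⁺ (Linked-reverse R-sym l)
      (subst (λ m → Connected R m (just x)) (sym (last-reverse (y ∷ xs))) (just (R-sym r))) [-]

  Linked-++⁻ : ∀ xs → Linked R (xs ++ ys) → Linked R xs × Linked R ys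
  Linked-++⁻ [] l = [] , l
  Linked-++⁻ (_ ∷ []) l = [-] , Linked.tail l
  Linked-++⁻ (_ ∷ _ ∷ xs) (r ∷ l) = let l₁ , l₂ = Linked-++⁻ (_ ∷ xs) l in r ∷ l₁ , l₂

  Linked-glue : Linked R xs → last xs ≡ just z → Linked R (z ∷ ys) → Linked R (xs ++ ys)
  Linked-glue {ys = ys} l e l′ =
    Linked-++⁺ l (subst (λ m → Connected R m (head ys)) (sym e) (head′ l′)) (Linked.tail l′)

module _ {n : ℕ} {P : Fin n → Set} (P? : ∀ z → Dec (P z)) where

  subsetOf : Subset n
  subsetOf = Vec.tabulate (does ∘ P?)

  ∈-subsetOf⁺ : ∀ {z} → P z → z ∈ₛ subsetOf
  ∈-subsetOf⁺ {z} pz =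
    lookup⇒[]= z subsetOf (trans (lookup∘tabulate (does ∘ P?) z) (dec-true (P? z) pz))

  ∈-subsetOf⁻ : ∀ {z} → z ∈ₛ subsetOf → P z
  ∈-subsetOf⁻ {z} z∈ with P? z | trans (sym (lookup∘tabulate (does ∘ P?) z)) ([]=⇒lookup z∈)
  ... | yes pz | _ = pz

least : ∀ {m} {P : Fin m → Set} → (∀ i → Dec (P i)) →
        (Σ (Fin m) λ i → P i × ∀ j → P j → i Fin.≤ j) ⊎ (∀ i → ¬ P i)
least {zero} P? = inj₂ λ ()
least {suc m} P? with P? Fin.zero | least (P? ∘ Fin.suc)
... | yes p | _ = inj₁ (Fin.zero , p , λ _ _ → z≤n)
... | no ¬p | inj₁ (i , p , min) =
  inj₁ (Fin.suc i , p , λ { Fin.zero p₀ → ⊥-elim (¬p p₀) ; (Fin.suc j) pj → s≤s (min j pj) })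
... | no ¬p | inj₂ none = inj₂ λ { Fin.zero → ¬p ; (Fin.suc j) → none j }

greatest : ∀ {m} {P : Fin m → Set} → (∀ i → Dec (P i)) →
           (Σ (Fin m) λ i → P i × ∀ j → P j → j Fin.≤ i) ⊎ (∀ i → ¬ P i)
greatest {zero} P? = inj₂ λ ()
greatest {suc m} P? with greatest (P? ∘ Fin.suc) | P? Fin.zero
... | inj₁ (i , p , max) | _ =
  inj₁ (Fin.suc i , p , λ { Fin.zero _ → z≤n ; (Fin.suc j) pj → s≤s (max j pj) })
... | inj₂ none | yes p =
  inj₁ (Fin.zero , p , λ { Fin.zero _ → z≤n ; (Fin.suc j) pj → ⊥-elim (none j pj) })
... | inj₂ none | no ¬p = inj₂ λ { Fin.zero → ¬p ; (Fin.suc j) → none j }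

x∈p∧y∈p∧x≢y⇒1<∣p∣ : ∀ {n} {S : Subset n} {x y} → x ∈ₛ S → y ∈ₛ S → x ≢ y → 1 < ∣ S ∣
x∈p∧y∈p∧x≢y⇒1<∣p∣ {S = S} {x} x∈S y∈S x≢y =
  subst (_< ∣ S ∣) (∣⁅x⁆∣≡1 x) (p⊂q⇒∣p∣<∣q∣ (singleton⊆ , _ , y∈S , x≢y ∘ sym ∘ x∈⁅y⁆⇒x≡y x))
  where
  singleton⊆ : ∀ {z} → z ∈ₛ ⁅ x ⁆ → z ∈ₛ S
  singleton⊆ z∈ = subst (_∈ₛ S) (sym (x∈⁅y⁆⇒x≡y x z∈)) x∈S

Unique-lookup-injective : ∀ {A : Set} {xs : List A} → Unique xs →
                          ∀ i j → List.lookup xs i ≡ List.lookup xs j → i ≡ j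
Unique-lookup-injective {xs = _ ∷ _} _ Fin.zero Fin.zero _ = refl
Unique-lookup-injective {xs = _ ∷ xs} u Fin.zero (Fin.suc j) e =
  ⊥-elim (head∉tail u (subst (_∈ xs) (sym e) (∈-lookup j)))
Unique-lookup-injective {xs = _ ∷ xs} u (Fin.suc i) Fin.zero e =
  ⊥-elim (head∉tail u (subst (_∈ xs) e (∈-lookup i)))
Unique-lookup-injective {xs = _ ∷ _} (_ ∷ u) (Fin.suc i) (Fin.suc j) e =
  cong Fin.suc (Unique-lookup-injective u i j e)

Unique-length≤ : ∀ {n} {xs : List (Fin n)} → Unique xs → length xs ≤ n
Unique-length≤ {n} {xs} u with length xs ≤? n
... | yes ≤n = ≤n
... | no ≰n with pigeonhole (≰⇒> ≰n) (List.lookup xs)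
...   | i , j , i<j , e = ⊥-elim (<-irrefl (cong Fin.toℕ (Unique-lookup-injective u i j e)) i<j)

-- Paths in graphs and trees

module _ {n : ℕ} (G : Graph n) where

  open import Data.List.Membership.DecPropositional (_≟_ {n}) using (_∈?_)

  private variable
    u v y z : Fin n
    p q xs ys : List (Fin n)

  IsPath-∷ : Adj G u y → u ∉ p → IsPath G y v p → IsPath G u v (u ∷ p)
  IsPath-∷ {p = _ ∷ _} u~y u∉p (l , un , refl , e) = u~y ∷ l , ¬Any⇒All¬ _ u∉p ∷ un , refl , e

  IsPath-tail : IsPath G u v (z ∷ y ∷ p) → IsPath G y v (y ∷ p)
  IsPath-tail (_ ∷ l , _ ∷ un , _ , e) = l , un , refl , e

  IsPath-split : ∀ xs → IsPath G u v (xs ++ z ∷ ys) → IsPath G u z (xs ∷ʳ z) × IsPath G z v (z ∷ ys)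
  IsPath-split {z = z} {ys} xs (l , un , h , e)
    with Linked-++⁻ (xs ∷ʳ z) (subst (Linked (Adj G)) (sym (++-assoc xs [ z ] ys)) l)
       | Unique-++⁻ (xs ∷ʳ z) (subst Unique (sym (++-assoc xs [ z ] ys)) un)
  ... | l₁ , _ | u₁ , _ =
    (l₁ , u₁ , trans (head-++-∷ xs) h , last-∷ʳ xs) ,
    (proj₂ (Linked-++⁻ xs l) , proj₁ (proj₂ (Unique-++⁻ xs un)) , refl , trans (sym (last-++-∷ xs)) e)

  walk⇒path : Linked (Adj G) (u ∷ xs) → last (u ∷ xs) ≡ just v → ∃ λ p → IsPath G u v p × p ⊆ u ∷ xs
  walk⇒path {u} {[]} [-] refl = [ u ] , ([-] , [] ∷ [] , refl , refl) , id
  walk⇒path {u} {y ∷ xs} (u~y ∷ l) e with walk⇒path l e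
  ... | p , P , p⊆ with u ∈? p
  ...   | no u∉p = u ∷ p , IsPath-∷ u~y u∉p P , ∷⁺ʳ u p⊆
  ...   | yes u∈p = let A , B , p≡ = ∈-∃++ {xs = p} u∈p in
    u ∷ B , proj₂ (IsPath-split A (subst (IsPath G y _) p≡ P)) ,
    ⊆-trans (subst (u ∷ B ⊆_) (sym p≡) (xs⊆ys++xs (u ∷ B) A)) (⊆-trans p⊆ (xs⊆x∷xs _ u))

  path-within-++ : IsPath G u z p → IsPath G z v q → ∃ λ r → IsPath G u v r × r ⊆ p ++ q
  path-within-++ {p = x ∷ p} {q = _ ∷ q} (l , _ , refl , e) (l′ , _ , refl , e′)
    with walk⇒path (Linked-glue l e l′) (last-glue {xs = x ∷ p} {ys = q} e e′)
  ... | r , R , r⊆ = r , R , ⊆-trans r⊆ (++⁺ʳ (x ∷ p) (xs⊆x∷xs q _))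

IsPath-length≤ : ∀ {n} {G : Graph n} {u v p} → IsPath G u v p → length p ≤ n
IsPath-length≤ (_ , un , _) = Unique-length≤ un

Dist⇒< : ∀ {n} {G : Graph n} {s t d} → Dist G s t d → d < n
Dist⇒< (_ , P , len) = subst (_≤ _) len (IsPath-length≤ P)

module _ {n w : ℕ} {G : Graph n} (D : PathDecomposition G w) where

  open PathDecomposition D

  -- Consecutive vertices share a bag, and the bags holding a vertex form an interval.
  walk-meets-bags : ∀ {x y a b i xs} → Linked (Adj G) (x ∷ xs) → last (x ∷ xs) ≡ just y →
                    x ∈ₛ bag a → y ∈ₛ bag b → a Fin.≤ i → i Fin.≤ b →
                    Σ (Fin n) λ q → q ∈ x ∷ xs × q ∈ₛ bag i
  walk-meets-bags {x} {xs = []} [-] refl x∈a x∈b a≤i i≤b =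
    x , here refl , interval x _ _ _ a≤i i≤b x∈a x∈b
  walk-meets-bags {x} {i = i} {xs = x′ ∷ xs} (x~x′ ∷ l) e x∈a y∈b a≤i i≤b with edges x x′ x~x′
  ... | c , x∈c , x′∈c with i Fin.≤? c
  ...   | yes i≤c = x , here refl , interval x _ _ _ a≤i i≤c x∈a x∈c
  ...   | no i≰c with walk-meets-bags l e x′∈c y∈b (<⇒≤ (≰⇒> i≰c)) i≤b
  ...     | q , q∈ , q∈i = q , there q∈ , q∈i

pathwidth≤n : ∀ {n} {G : Graph n} {k} → Pathwidth G k → k ≤ n
pathwidth≤n {n} (_ , minimal) = minimal n record
  { m = 1 ; bag = λ _ → ⊤ ; covers = λ _ → Fin.zero , ∈⊤ ; edges = λ _ _ _ → Fin.zero , ∈⊤ , ∈⊤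
  ; interval = λ _ _ _ _ _ _ _ _ → ∈⊤ ; width≤ = λ _ → subst (_≤ suc n) (sym (∣⊤∣≡n n)) (n≤1+n n) }

module Tree {n : ℕ} {G : Graph n} (T : IsTree G) where

  open IsTree T

  private variable
    a b t u v x y z : Fin n
    p q : List (Fin n)
    r : Response n

  IsPath-reverse : IsPath G u v p → IsPath G v u (reverse p)
  IsPath-reverse {p = p} (l , un , h , e) =
    Linked-reverse (symmetric _ _) l , Unique-reverse un , trans (head-reverse p) e , trans (last-reverse p) h

  -- Two different first steps towards v would close a cycle through u.
  no-fork : IsPath G u v (u ∷ a ∷ p) → IsPath G u v (u ∷ b ∷ q) → a ≢ b → ⊥
  no-fork {u} {a = a} {p} {b} {q} P@(u~a ∷ _ , u∉ ∷ _ , _) Q@(u~b ∷ _ , u∉′ ∷ _ , _) a≢b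
    with path-within-++ G (IsPath-tail G Q) (IsPath-reverse (IsPath-tail G P))
  ... | b ∷ [] , (_ , _ , refl , refl) , _ = a≢b refl
  ... | r@(b ∷ c ∷ cs) , (lr , ur , refl , er) , r⊆ =
    acyclic (u ∷ r) ( s≤s (s≤s (s≤s z≤n)) , u~b ∷ lr , ¬Any⇒All¬ r u∉r ∷ ur
                    , u , a , refl , er , symmetric u a u~a)
    where
    u∉r : u ∉ r
    u∉r u∈r with ∈-++⁻ (b ∷ q) (r⊆ u∈r)
    ... | inj₁ u∈q = All¬⇒¬Any u∉′ u∈q
    ... | inj₂ u∈p = All¬⇒¬Any u∉ (reverse⁻ u∈p)

  IsPath-step-unique : IsPath G u v (u ∷ a ∷ p) → IsPath G u v (u ∷ b ∷ q) → a ≡ b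
  IsPath-step-unique {a = a} {b = b} P Q with a ≟ b
  ... | yes a≡b = a≡b
  ... | no a≢b = ⊥-elim (no-fork P Q a≢b)

  IsPath-unique : IsPath G u v p → IsPath G u v q → p ≡ q
  IsPath-unique {p = _ ∷ []} {q = _ ∷ []} (_ , _ , refl , _) (_ , _ , refl , _) = refl
  IsPath-unique {p = _ ∷ []} {q = _ ∷ _ ∷ _} (_ , _ , refl , refl) (_ , un , refl , e) =
    ⊥-elim (head∉tail un (last-∈ e))
  IsPath-unique {p = _ ∷ _ ∷ _} {q = _ ∷ []} (_ , un , refl , e) (_ , _ , refl , refl) =
    ⊥-elim (head∉tail un (last-∈ e))
  IsPath-unique {v = v} {p = x ∷ a ∷ p} {q = _ ∷ b ∷ q} P@(_ , _ , refl , _) Q@(_ , _ , refl , _) =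
    cong (x ∷_) (trans (IsPath-unique (IsPath-tail G P) Q′) (cong (_∷ q) a≡b))
    where
    a≡b : a ≡ b
    a≡b = IsPath-step-unique P Q
    Q′ : IsPath G a v (a ∷ q)
    Q′ = subst (λ c → IsPath G c v (c ∷ q)) (sym a≡b) (IsPath-tail G Q)

  path : Fin n → Fin n → List (Fin n)
  path u v = proj₁ (connected u v)

  path-IsPath : ∀ u v → IsPath G u v (path u v)
  path-IsPath u v = proj₂ (connected u v)

  ∈-path-start : ∀ u v → u ∈ path u v
  ∈-path-start u v with path u v | path-IsPath u v
  ... | _ ∷ _ | (_ , _ , refl , _) = here refl

  ∈-path-end : ∀ u v → v ∈ path u v
  ∈-path-end u v = last-∈ (proj₂ (proj₂ (proj₂ (path-IsPath u v))))

  ≡path : IsPath G u v p → p ≡ path u v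
  ≡path P = IsPath-unique P (path-IsPath _ _)

  path-split : z ∈ path u v → ∃₂ λ A B → path u v ≡ A ++ z ∷ B × path u z ≡ A ∷ʳ z × path z v ≡ z ∷ B
  path-split {u = u} {v} z∈ with ∈-∃++ z∈
  ... | A , B , e with IsPath-split G A (subst (IsPath G u v) e (path-IsPath u v))
  ...   | P₁ , P₂ = A , B , e , sym (≡path P₁) , sym (≡path P₂)

  path-prefix : z ∈ path u v → path u z ⊆ path u v
  path-prefix z∈ {x} x∈ with path-split z∈
  ... | A , B , e₁ , e₂ , _ with ∈-++⁻ A (subst (x ∈_) e₂ x∈)
  ...   | inj₁ x∈A = subst (x ∈_) (sym e₁) (∈-++⁺ˡ x∈A)
  ...   | inj₂ (here refl) = subst (x ∈_) (sym e₁) (∈-++⁺ʳ A (here refl))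

  path-suffix : z ∈ path u v → path z v ⊆ path u v
  path-suffix z∈ {x} x∈ with path-split z∈
  ... | A , B , e₁ , _ , e₃ = subst (x ∈_) (sym e₁) (∈-++⁺ʳ A (subst (x ∈_) e₃ x∈))

  length-path-suffix : z ∈ path u v → length (path z v) ≤ length (path u v)
  length-path-suffix {z} {u} {v} z∈ with path-split z∈
  ... | A , B , e₁ , _ , e₃ = begin
    length (path z v)         ≡⟨ cong length e₃ ⟩
    length (z ∷ B)            ≤⟨ m≤n+m _ (length A) ⟩
    length A + length (z ∷ B) ≡⟨ sym (length-++ A) ⟩
    length (A ++ z ∷ B)       ≡⟨ cong length (sym e₁) ⟩
    length (path u v)         ∎
    where open ≤-Reasoning

  path-⊆-via : ∀ y → path a b ⊆ path y a ++ path y b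
  path-⊆-via {a} {b} y {x} x∈ with path-within-++ G (IsPath-reverse (path-IsPath y a)) (path-IsPath y b)
  ... | r , R , r⊆ with ∈-++⁻ (reverse (path y a)) (r⊆ (subst (x ∈_) (sym (≡path R)) x∈))
  ...   | inj₁ x∈ya = ∈-++⁺ˡ (reverse⁻ {xs = path y a} x∈ya)
  ...   | inj₂ x∈yb = ∈-++⁺ʳ (path y a) x∈yb

  answer-toward : IsPath G z t (z ∷ y ∷ p) → ValidAnswer G t z r → r ≡ toward y
  answer-toward (_ , un , _ , e) found = ⊥-elim (head∉tail un (last-∈ e))
  answer-toward P (step _ (_ , P′)) with IsPath-unique P P′
  ... | refl = refl

  answer-here : ValidAnswer G t z here → z ≡ t
  answer-here found = refl

  answer-path : ValidAnswer G t z (toward y) → path z t ≡ z ∷ path y t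
  answer-path {z = z} (step _ (_ , P)) = trans (sym (≡path P)) (cong (z ∷_) (≡path (IsPath-tail G P)))

  answer-along : ∀ {d w i} → IsPath G w t p → suc i < length p →
                 ValidAnswer G t (nth d p i) r → r ≡ toward (nth d p (suc i))
  answer-along {p = _ ∷ []} {i = zero} _ (s≤s ()) _
  answer-along {p = _ ∷ _ ∷ _} {i = zero} P@(_ , _ , refl , _) _ v = answer-toward P v
  answer-along {p = _ ∷ _ ∷ _} {i = suc i} P (s≤s i<) v = answer-along (IsPath-tail G P) i< v

  -- Along a branch x ∷ q leaving the path x ∷ π to t, every answer points back towards x.
  answer-back : ∀ {d π i} q → IsPath G x t (x ∷ π) → Linked (Adj G) (x ∷ q) → Unique (x ∷ q) →
                Disjoint (x ∷ q) π → i < length q →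
                ValidAnswer G t (nth d q i) r → r ≡ toward (nth d (x ∷ q) i)
  answer-back {x} {t} {r} {d} {π} {i} (y ∷ q) P (x~y ∷ l) (x≢ ∷ u) q#π = back i
    where
    y∉ : y ∉ x ∷ π
    y∉ (here refl) = All¬⇒¬Any x≢ (here refl)
    y∉ (there y∈π) = q#π (there (here refl) , y∈π)
    P′ : IsPath G y t (y ∷ x ∷ π)
    P′ = IsPath-∷ G (symmetric x y x~y) y∉ P
    q#π′ : Disjoint (y ∷ q) (x ∷ π)
    q#π′ (v∈ , here refl) = All¬⇒¬Any x≢ v∈
    q#π′ (v∈ , there v∈π) = q#π (there v∈ , v∈π)
    back : ∀ i → i < length (y ∷ q) →
           ValidAnswer G t (nth d (y ∷ q) i) r → r ≡ toward (nth d (x ∷ y ∷ q) i)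
    back zero _ v = answer-toward P′ v
    back (suc i) (s≤s i<) v = answer-back q P′ l u q#π′ i< v

  branches-disjoint : IsPath G x a (x ∷ p) → IsPath G x b (x ∷ q) →
                      (∀ {y} → head p ≡ just y → head q ≢ just y) → Disjoint p q
  branches-disjoint {x} {p = p} {q = q} P Q diverge {z} (z∈p , z∈q)
    with ∈-∃++ z∈p | ∈-∃++ z∈q
  ... | A , B , p≡ | A′ , B′ , q≡ = diverge hp (trans (sym p≡q) hp)
    where
    prefix : ∀ {b l} A B → IsPath G x b (x ∷ l) → l ≡ A ++ z ∷ B → IsPath G x z (x ∷ A ∷ʳ z)
    prefix A B P l≡ = proj₁ (IsPath-split G (x ∷ A) (subst (λ l → IsPath G x _ (x ∷ l)) l≡ P))
    same : A ∷ʳ z ≡ A′ ∷ʳ z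
    same = ∷-injectiveʳ (IsPath-unique (prefix A B P p≡) (prefix A′ B′ Q q≡))
    p≡q : head p ≡ head q
    p≡q = begin
      head p             ≡⟨ cong head p≡ ⟩
      head (A ++ z ∷ B)   ≡⟨ head-++-∷ A ⟩
      head (A ∷ʳ z)       ≡⟨ cong head same ⟩
      head (A′ ∷ʳ z)      ≡⟨ head-++-∷ A′ ⟩
      head (A′ ++ z ∷ B′) ≡⟨ cong head (sym q≡) ⟩
      head q             ∎
      where open ≡-Reasoning
    hp : head p ≡ just (nth z A 0)
    hp = trans (cong head p≡) (head-++-nth A)

-- Galloping search along a path

FindsWithin-mono : ∀ {n} {G : Graph n} {t σ q q′} → FindsWithin G t σ q → q ≤ q′ → FindsWithin G t σ q′
FindsWithin-mono done _ = done
FindsWithin-mono (query next) (s≤s q≤q′) = query λ r v → FindsWithin-mono (next r v) q≤q′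

mersenne : ℕ → ℕ
mersenne zero = zero
mersenne (suc j) = suc (mersenne j + mersenne j)

suc-mersenne : ∀ j → suc (mersenne j) ≡ 2 ^ j
suc-mersenne zero = refl
suc-mersenne (suc j) = begin
  suc (suc (mersenne j + mersenne j)) ≡⟨ cong suc (sym (+-suc (mersenne j) (mersenne j))) ⟩
  suc (mersenne j) + suc (mersenne j) ≡⟨ cong₂ _+_ (suc-mersenne j) (suc-mersenne j) ⟩
  2 ^ j + 2 ^ j                       ≡⟨ cong (2 ^ j +_) (sym (+-identityʳ (2 ^ j))) ⟩
  2 * 2 ^ j                           ∎
  where open ≡-Reasoning

j≤mersenne : ∀ j → j ≤ mersenne j
j≤mersenne zero = z≤n
j≤mersenne (suc j) = s≤s (≤-trans (j≤mersenne j) (m≤m+n _ _))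

-- After forward answers at the indices mersenne 0, …, mersenne (j - 1) the target index is at
-- least lowerBound j.
lowerBound : ℕ → ℕ
lowerBound zero = zero
lowerBound (suc j) = suc (mersenne j)

lowerBound-mersenne : ∀ j → lowerBound j + mersenne (pred j) ≡ mersenne j
lowerBound-mersenne zero = refl
lowerBound-mersenne (suc j) = refl

j≤lowerBound : ∀ j → j ≤ lowerBound j
j≤lowerBound zero = z≤n
j≤lowerBound (suc j) = s≤s (j≤mersenne j)

mersenne<⇒≤log : ∀ {j e} → mersenne j < e → j ≤ ⌊log₂ e ⌋
mersenne<⇒≤log {j} {e} lt =
  subst (_≤ ⌊log₂ e ⌋) (⌊log₂[2^n]⌋≡n j) (⌊log₂⌋-mono-≤ (subst (_≤ e) (suc-mersenne j) lt))

searchCost : ℕ → ℕ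
searchCost e = 3 + 2 * ⌊log₂ e ⌋

searchCost-mono : ∀ {e d} → e ≤ d → searchCost e ≤ searchCost d
searchCost-mono e≤d = +-monoʳ-≤ 3 (*-monoʳ-≤ 2 (⌊log₂⌋-mono-≤ e≤d))

spare-budget : ∀ {e j c} → j ≤ suc ⌊log₂ e ⌋ → searchCost e ≤ j + c → suc ⌊log₂ e ⌋ < c
spare-budget {e} {j} {c} j≤ budget = +-cancelˡ-≤ (suc L) _ _ (begin
  suc L + suc (suc L) ≡⟨ split L ⟩
  searchCost e        ≤⟨ budget ⟩
  j + c               ≤⟨ +-monoˡ-≤ c j≤ ⟩
  suc L + c           ∎)
  where
  L : ℕ
  L = ⌊log₂ e ⌋
  open ≤-Reasoning
  split : ∀ L → suc L + suc (suc L) ≡ 3 + 2 * L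
  split = solve-∀

data Direction : Set where
  forward backward stop : Direction

select : {A : Set} → Direction → A → A → A → A
select forward  onForward _ _ = onForward
select backward _ onBackward _ = onBackward
select stop     _ _ onStop = onStop

-- Galloping search for an unknown index e ≤ m along the vertices ρ 0, …, ρ m:
-- the answer at ρ i points to ρ (i + 1) for i < e and to ρ (i - 1) for i > e.
-- At e the search hands the answer over to κ e.
module Gallop {n : ℕ} (ρ : ℕ → Fin n) (m : ℕ) where

  direction : ℕ → Response n → Direction
  direction i here = stop
  direction i (toward y) with i <? m ×-dec y ≟ ρ (suc i) | 0 <? i ×-dec y ≟ ρ (pred i)
  ... | yes _ | _ = forward
  ... | no _ | yes _ = backward
  ... | no _ | no _ = stop

  direction-forward : ∀ {i} → i < m → direction i (toward (ρ (suc i))) ≡ forward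
  direction-forward {i} i<m with i <? m ×-dec ρ (suc i) ≟ ρ (suc i)
  ... | yes _ = refl
  ... | no ¬p = ⊥-elim (¬p (i<m , refl))

  direction-backward : ∀ {i} → 0 < i → (i < m → ρ (pred i) ≢ ρ (suc i)) →
                       direction i (toward (ρ (pred i))) ≡ backward
  direction-backward {i} 0<i distinct
    with i <? m ×-dec ρ (pred i) ≟ ρ (suc i) | 0 <? i ×-dec ρ (pred i) ≟ ρ (pred i)
  ... | yes (i<m , e) | _ = ⊥-elim (distinct i<m e)
  ... | no _ | yes _ = refl
  ... | no _ | no ¬p = ⊥-elim (¬p (0<i , refl))

  direction-stop : ∀ {i y} → (i < m → y ≢ ρ (suc i)) → (0 < i → y ≢ ρ (pred i)) →
                   direction i (toward y) ≡ stop
  direction-stop {i} {y} ¬fwd ¬bwd with i <? m ×-dec y ≟ ρ (suc i) | 0 <? i ×-dec y ≟ ρ (pred i)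
  ... | yes (i<m , e) | _ = ⊥-elim (¬fwd i<m e)
  ... | no _ | yes (0<i , e) = ⊥-elim (¬bwd 0<i e)
  ... | no _ | no _ = refl

  record Target (G : Graph n) (t : Fin n) (e : ℕ) : Set where
    field
      e≤m : e ≤ m
      before : ∀ {i r} → i < e → ValidAnswer G t (ρ i) r → direction i r ≡ forward
      after : ∀ {i r} → e < i → i ≤ m → ValidAnswer G t (ρ i) r → direction i r ≡ backward
      at : ∀ {r} → ValidAnswer G t (ρ e) r → direction e r ≡ stop

  module _ (κ : ℕ → Response n → Strategy n) where

    probe : ℕ → Strategy n → Strategy n → Strategy n
    probe i onForward onBackward = query (ρ i) λ r → select (direction i r) onForward onBackward (κ i r)

    bisect : ℕ → ℕ → Strategy n
    bisect zero lo = done (ρ lo)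
    bisect (suc f) lo with m <? lo + mersenne f
    ... | yes _ = bisect f lo
    ... | no _ = probe (lo + mersenne f) (bisect f (suc (lo + mersenne f))) (bisect f lo)

    double : ℕ → ℕ → Strategy n
    double zero j = done (ρ 0)
    double (suc fuel) j with m <? mersenne j
    ... | yes _ = bisect (pred j) (lowerBound j)
    ... | no _ = probe (mersenne j) (double fuel (suc j)) (bisect (pred j) (lowerBound j))

    gallop : Strategy n
    gallop = double (suc m) 0

    module _ {G : Graph n} {t : Fin n} {e : ℕ} (target : Target G t e) {q : ℕ}
             (continue : ∀ {r} → ValidAnswer G t (ρ e) r → FindsWithin G t (κ e r) q) where

      open Target target

      private
        FW : Strategy n → ℕ → Set
        FW = FindsWithin G t

      probe-finds : ∀ {i c onForward onBackward} → i ≤ m →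
                    (i < e → FW onForward (c + q)) → (e < i → FW onBackward (c + q)) →
                    FW (probe i onForward onBackward) (suc c + q)
      probe-finds {i} {c} {onForward} {onBackward} i≤m fwd bwd = query λ r v → go r v (<-cmp i e)
        where
        go : ∀ r → ValidAnswer G t (ρ i) r → Tri (i < e) (i ≡ e) (e < i) →
             FW (select (direction i r) onForward onBackward (κ i r)) (c + q)
        go r v (tri< i<e _ _) rewrite before i<e v = fwd i<e
        go r v (tri> _ _ e<i) rewrite after e<i i≤m v = bwd e<i
        go r v (tri≈ _ refl _) rewrite at v = FindsWithin-mono (continue v) (m≤n+m q c)

      bisect-finds : ∀ f lo → lo ≤ e → e < lo + mersenne f → FW (bisect f lo) (f + q)
      bisect-finds zero lo lo≤e e< =
        ⊥-elim (<-irrefl refl (<-≤-trans (subst (e <_) (+-identityʳ lo) e<) lo≤e))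
      bisect-finds (suc f) lo lo≤e e< with m <? lo + mersenne f
      ... | yes m<mid = FindsWithin-mono (bisect-finds f lo lo≤e (≤-<-trans e≤m m<mid)) (n≤1+n (f + q))
      ... | no m≮mid = probe-finds (≮⇒≥ m≮mid)
                         (λ mid<e → bisect-finds f (suc (lo + mersenne f)) mid<e (subst (e <_) (upper lo) e<))
                         (λ e<mid → bisect-finds f lo lo≤e e<mid)
        where
        upper : ∀ lo → lo + mersenne (suc f) ≡ suc (lo + mersenne f) + mersenne f
        upper lo = trans (+-suc lo _) (cong suc (sym (+-assoc lo _ _)))

      bisect-lowerBound-finds : ∀ j {c} → lowerBound j ≤ e → e < mersenne j → pred j ≤ c →
                                FW (bisect (pred j) (lowerBound j)) (c + q)
      bisect-lowerBound-finds j lo≤e e< j≤c =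
        FindsWithin-mono (bisect-finds (pred j) (lowerBound j) lo≤e (subst (e <_) (sym (lowerBound-mersenne j)) e<))
                         (+-monoˡ-≤ q j≤c)

      double-finds : ∀ fuel j c → lowerBound j ≤ e → e < fuel + j → j ≤ suc ⌊log₂ e ⌋ →
                     searchCost e ≤ j + c → FW (double fuel j) (c + q)
      double-finds zero j c lo≤e e< _ _ =
        ⊥-elim (<-irrefl refl (<-≤-trans e< (≤-trans (j≤lowerBound j) lo≤e)))
      double-finds (suc fuel) j c lo≤e e< j≤ budget with m <? mersenne j | spare-budget {e} j≤ budget
      ... | yes m<M | L<c =
        bisect-lowerBound-finds j lo≤e (≤-<-trans e≤m m<M) (≤-trans (pred-mono-≤ j≤) (<⇒≤ (<⇒≤ L<c)))
      ... | no m≮M | s≤s {n = c′} L<c′ = probe-finds (≮⇒≥ m≮M) fwd bwd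
        where
        fwd : mersenne j < e → FW (double fuel (suc j)) (c′ + q)
        fwd M<e = double-finds fuel (suc j) c′ M<e (subst (e <_) (sym (+-suc fuel j)) e<)
                    (s≤s (mersenne<⇒≤log M<e)) (subst (searchCost e ≤_) (+-suc j c′) budget)
        bwd : e < mersenne j → FW (bisect (pred j) (lowerBound j)) (c′ + q)
        bwd e<M = bisect-lowerBound-finds j lo≤e e<M (≤-trans (pred-mono-≤ j≤) (<⇒≤ L<c′))

      gallop-finds : FW gallop (searchCost e + q)
      gallop-finds =
        double-finds (suc m) 0 (searchCost e) z≤n (s≤s (subst (e ≤_) (sym (+-identityʳ m)) e≤m)) z≤n ≤-refl

module Exits {n : ℕ} {G : Graph n} (T : IsTree G) where

  open Tree T

  record Exit (w a t : Fin n) : Set where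
    field
      stem : List (Fin n)
      fork : Fin n
      toA toT : List (Fin n)
      path-wa : path w a ≡ stem ++ fork ∷ toA
      path-wt : path w t ≡ stem ++ fork ∷ toT
      wa#toT : Disjoint (path w a) toT

  exit : ∀ w a t → Exit w a t
  exit w a t with path w a in wa≡ | path-IsPath w a | path w t in wt≡ | path-IsPath w t
  ... | _ ∷ p | Pa@(_ , _ , refl , _) | _ ∷ q | Pt@(_ , _ , refl , _) =
    record { stem = stem ; fork = fork ; toA = xs′ ; toT = ys′
           ; path-wa = trans wa≡ xs≡ ; path-wt = trans wt≡ ys≡ ; wa#toT = wa#toT }
    where
    open Fork (longestCommonPrefix _≟_ w p q)
    Pfa : IsPath G fork a (fork ∷ xs′)
    Pfa = proj₂ (IsPath-split G stem (subst (IsPath G w a) xs≡ Pa))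
    Pft : IsPath G fork t (fork ∷ ys′)
    Pft = proj₂ (IsPath-split G stem (subst (IsPath G w t) ys≡ Pt))
    stem#ft : Disjoint stem (fork ∷ ys′)
    stem#ft = proj₂ (proj₂ (Unique-++⁻ stem (subst Unique ys≡ (proj₁ (proj₂ Pt)))))
    wa#toT : Disjoint (path w a) ys′
    wa#toT {v} (v∈wa , v∈ys′) with ∈-++⁻ stem (subst (v ∈_) (trans wa≡ xs≡) v∈wa)
    ... | inj₁ v∈stem = stem#ft (v∈stem , there v∈ys′)
    ... | inj₂ (here refl) = head∉tail (proj₁ (proj₂ Pft)) v∈ys′
    ... | inj₂ (there v∈xs′) = branches-disjoint Pfa Pft diverge (v∈xs′ , v∈ys′)

  continueAt : (ℕ → Fin n) → (Fin n → Fin n → Strategy n) → ℕ → Response n → Strategy n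
  continueAt ρ k i here = done (ρ i)
  continueAt ρ k i (toward y) = k (ρ i) y

  exitSearch : Fin n → Fin n → (Fin n → Fin n → Strategy n) → Strategy n
  exitSearch w a k = Gallop.gallop ρ (pred (length (path w a))) (continueAt ρ k)
    where
    ρ : ℕ → Fin n
    ρ = nth w (path w a)

  module _ (w a t : Fin n) where

    open Exit (exit w a t)
    open Gallop (nth w (path w a)) (pred (length (path w a)))

    private
      ρ : ℕ → Fin n
      ρ = nth w (path w a)
      m : ℕ
      m = pred (length (path w a))
      e : ℕ
      e = length stem
      FW : Strategy n → ℕ → Set
      FW = FindsWithin G t
      Pfa : IsPath G fork a (fork ∷ toA)
      Pfa = proj₂ (IsPath-split G stem (subst (IsPath G w a) path-wa (path-IsPath w a)))
      Pft : IsPath G fork t (fork ∷ toT)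
      Pft = proj₂ (IsPath-split G stem (subst (IsPath G w t) path-wt (path-IsPath w t)))

    length-wa : length (path w a) ≡ suc (e + length toA)
    length-wa = trans (cong length path-wa) (trans (length-++ stem) (+-suc e _))

    m≡ : m ≡ e + length toA
    m≡ = cong pred length-wa

    <length-wa : ∀ {i} → i ≤ m → i < length (path w a)
    <length-wa {i} i≤m = subst (i <_) (sym length-wa) (s≤s (subst (i ≤_) m≡ i≤m))

    ρ-∈ : ∀ {i} → i ≤ m → ρ i ∈ path w a
    ρ-∈ i≤m = nth-∈ (<length-wa i≤m)

    ρ-fork : ρ e ≡ fork
    ρ-fork = trans (cong (λ p → nth w p e) path-wa) (nth-++-∷ stem)

    length-wt : length (path w t) ≡ suc (e + length toT)
    length-wt = trans (cong length path-wt) (trans (length-++ stem) (+-suc e _))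

    e≤m : e ≤ m
    e≤m = subst (e ≤_) (sym m≡) (m≤m+n e _)

    same-prefix : ∀ {i} → i ≤ e → ρ i ≡ nth w (path w t) i
    same-prefix {i} i≤e = begin
      nth w (path w a) i           ≡⟨ cong (λ p → nth w p i) path-wa ⟩
      nth w (stem ++ fork ∷ toA) i ≡⟨ nth-common-prefix stem i≤e ⟩
      nth w (stem ++ fork ∷ toT) i ≡⟨ cong (λ p → nth w p i) (sym path-wt) ⟩
      nth w (path w t) i           ∎
      where open ≡-Reasoning

    forward-before : ∀ {i r} → i < e → ValidAnswer G t (ρ i) r → direction i r ≡ forward
    forward-before {i} {r} i<e v =
      subst (λ r → direction i r ≡ forward) (sym r≡) (direction-forward (<-≤-trans i<e e≤m))
      where
      suc-i< : suc i < length (path w t)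
      suc-i< = subst (suc i <_) (sym length-wt) (s≤s (≤-trans i<e (m≤m+n e _)))
      r≡ : r ≡ toward (ρ (suc i))
      r≡ = trans (answer-along (path-IsPath w t) suc-i<
                    (subst (λ z → ValidAnswer G t z r) (same-prefix (<⇒≤ i<e)) v))
                 (cong toward (sym (same-prefix i<e)))

    backward-after : ∀ {i r} → e < i → i ≤ m → ValidAnswer G t (ρ i) r → direction i r ≡ backward
    backward-after {i} {r} e<i i≤m v with m≤n⇒∃[o]m+o≡n e<i
    ... | k , refl = subst (λ r → direction i r ≡ backward) (sym r≡) (direction-backward (s≤s z≤n) distinct)
      where
      ρ-branch : ∀ j → ρ (e + j) ≡ nth w (fork ∷ toA) j
      ρ-branch j = trans (cong (λ p → nth w p (e + j)) path-wa) (nth-++ stem)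
      ρ-i : ρ (suc e + k) ≡ nth w toA k
      ρ-i = trans (cong ρ (sym (+-suc e k))) (ρ-branch (suc k))
      k< : k < length toA
      k< = +-cancelˡ-≤ e _ _ (subst (_≤ e + length toA) (sym (+-suc e k)) (subst (suc e + k ≤_) m≡ i≤m))
      fork-toA#toT : Disjoint (fork ∷ toA) toT
      fork-toA#toT (v∈ , v∈toT) = wa#toT (subst (_ ∈_) (sym path-wa) (∈-++⁺ʳ stem v∈) , v∈toT)
      r≡ : r ≡ toward (ρ (e + k))
      r≡ = trans (answer-back toA Pft (proj₁ Pfa) (proj₁ (proj₂ Pfa)) fork-toA#toT k<
                    (subst (λ z → ValidAnswer G t z r) ρ-i v))
                 (cong toward (sym (ρ-branch k)))
      distinct : suc e + k < m → ρ (e + k) ≢ ρ (suc (suc e + k))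
      distinct i<m eq = <-irrefl (nth-injective (proj₁ (proj₂ (path-IsPath w a)))
                                   (<length-wa (≤-trans (n≤1+n _) (<⇒≤ i<m))) (<length-wa i<m) eq) (s≤s (n≤1+n _))

    toT⊆wt : toT ⊆ path w t
    toT⊆wt z∈ = subst (_ ∈_) (sym path-wt) (∈-++⁺ʳ stem (there z∈))

    path-fork-t : path fork t ≡ fork ∷ toT
    path-fork-t = sym (≡path Pft)

    fork∈wt : fork ∈ path w t
    fork∈wt = subst (fork ∈_) (sym path-wt) (∈-++⁺ʳ stem (here refl))

    fork∈wa : fork ∈ path w a
    fork∈wa = subst (fork ∈_) (sym path-wa) (∈-++⁺ʳ stem (here refl))

    stem<wt : e < length (path w t)
    stem<wt = subst (e <_) (sym length-wt) (s≤s (m≤m+n e _))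

    answer-at-fork : ∀ {y} → ValidAnswer G t fork (toward y) → path y t ≡ toT
    answer-at-fork v = ∷-injectiveʳ (trans (sym (answer-path v)) path-fork-t)

    stop-at-fork : ∀ {r} → ValidAnswer G t (ρ e) r → direction e r ≡ stop
    stop-at-fork {here} _ = refl
    stop-at-fork {toward y} v =
      direction-stop (λ e<m eq → y∉wa (subst (_∈ path w a) (sym eq) (ρ-∈ e<m)))
                     (λ _ eq → y∉wa (subst (_∈ path w a) (sym eq) (ρ-∈ (≤-trans pred[n]≤n e≤m))))
      where
      y∈toT : y ∈ toT
      y∈toT = subst (y ∈_) (answer-at-fork (subst (λ z → ValidAnswer G t z (toward y)) ρ-fork v))
                    (∈-path-start y t)
      y∉wa : y ∉ path w a
      y∉wa y∈ = wa#toT (y∈ , y∈toT)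

    exit-target : Target G t e
    exit-target = record { e≤m = e≤m ; before = forward-before ; after = backward-after ; at = stop-at-fork }

    exitSearch-finds : ∀ {q} k → (∀ {y} → ValidAnswer G t fork (toward y) → FW (k fork y) q) →
                       FW (exitSearch w a k) (searchCost e + q)
    exitSearch-finds {q} k next = gallop-finds (continueAt ρ k) exit-target continue
      where
      continue : ∀ {r} → ValidAnswer G t (ρ e) r → FW (continueAt ρ k e r) q
      continue {here} v = subst (λ x → FW (done x) q) (sym (answer-here v)) done
      continue {toward y} v =
        subst (λ x → FW (k x y) q) (sym ρ-fork) (next (subst (λ x → ValidAnswer G t x (toward y)) ρ-fork v))

-- The level strategy

module Regions {n : ℕ} {G : Graph n} (T : IsTree G) where

  open Tree T
  open import Data.List.Membership.DecPropositional (_≟_ {n}) using (_∈?_)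

  private variable
    a b y z : Fin n
    Q : List (Fin n)
    R S : Subset n

  Convex : Subset n → Set
  Convex R = ∀ {a b z} → a ∈ₛ R → b ∈ₛ R → z ∈ path a b → z ∈ₛ R

  in-region? : ∀ R Q y z → Dec (z ∈ₛ R × All (_∉ Q) (path y z))
  in-region? R Q y z = (z ∈ₛ? R) ×-dec all? (λ q → ¬? (q ∈? Q)) (path y z)

  region : Subset n → List (Fin n) → Fin n → Subset n
  region R Q y = subsetOf (in-region? R Q y)

  ∈-region⁺ : z ∈ₛ R → All (_∉ Q) (path y z) → z ∈ₛ region R Q y
  ∈-region⁺ {R = R} {Q} {y} z∈R avoids = ∈-subsetOf⁺ (in-region? R Q y) (z∈R , avoids)

  ∈-region⁻ : z ∈ₛ region R Q y → z ∈ₛ R × All (_∉ Q) (path y z)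
  ∈-region⁻ {R = R} {Q} {y} = ∈-subsetOf⁻ (in-region? R Q y)

  region-convex : Convex R → Convex (region R Q y)
  region-convex {R} {Q} {y} convex {a} {b} {z} a∈ b∈ z∈ab =
    ∈-region⁺ (convex (proj₁ (∈-region⁻ a∈)) (proj₁ (∈-region⁻ b∈)) z∈ab) (All.tabulate avoids)
    where
    avoids : ∀ {q} → q ∈ path y z → q ∉ Q
    avoids q∈yz with ∈-++⁻ (path y a) (path-⊆-via y z∈ab)
    ... | inj₁ z∈ya = All.lookup (proj₂ (∈-region⁻ a∈)) (path-prefix z∈ya q∈yz)
    ... | inj₂ z∈yb = All.lookup (proj₂ (∈-region⁻ b∈)) (path-prefix z∈yb q∈yz)

  region-shrinks : ∀ {q} S → q ∈ Q → q ∈ₛ S ∩ R → ∣ S ∩ region R Q y ∣ < ∣ S ∩ R ∣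
  region-shrinks {Q} {R} {y} {q} S q∈Q q∈SR = p⊂q⇒∣p∣<∣q∣ (shrink , q , q∈SR , q∉)
    where
    shrink : ∀ {z} → z ∈ₛ S ∩ region R Q y → z ∈ₛ S ∩ R
    shrink z∈ = let z∈S , z∈region = x∈p∩q⁻ S _ z∈ in x∈p∩q⁺ (z∈S , proj₁ (∈-region⁻ z∈region))
    q∉ : q ∉ₛ S ∩ region R Q y
    q∉ q∈ = All.lookup (proj₂ (∈-region⁻ (proj₂ (x∈p∩q⁻ S _ q∈)))) (∈-path-end y q) q∈Q

  region-narrower : ∀ {c} S → (Nonempty (S ∩ R) → Σ (Fin n) λ q → q ∈ Q × q ∈ₛ S ∩ R) →
                    ∣ S ∩ R ∣ ≤ suc c → ∣ S ∩ region R Q y ∣ ≤ c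
  region-narrower {R} {Q} {y} S hit SR≤ with nonempty? (S ∩ R)
  ... | yes ne = let q , q∈Q , q∈SR = hit ne in ≤-pred (≤-trans (region-shrinks S q∈Q q∈SR) SR≤)
  ... | no ¬ne = subst (_≤ _) (sym (trans (cong ∣_∣ (Empty-unique empty)) (∣⊥∣≡0 n))) z≤n
    where
    empty : Empty (S ∩ region R Q y)
    empty (z , z∈) = let z∈S , z∈region = x∈p∩q⁻ S _ z∈ in
                     ¬ne (z , x∈p∩q⁺ (z∈S , proj₁ (∈-region⁻ z∈region)))

module Levels {n : ℕ} {G : Graph n} (T : IsTree G) {k : ℕ} (D : PathDecomposition G k) where

  open Tree T
  open Exits T
  open Regions T
  open PathDecomposition D

  record Spine (R : Subset n) : Set where
    field
      u v : Fin n
      u∈R : u ∈ₛ R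
      v∈R : v ∈ₛ R
      meets : ∀ i → Nonempty (bag i ∩ R) → Σ (Fin n) λ q → q ∈ path u v × q ∈ₛ bag i

  spine? : ∀ R → Spine R ⊎ (∀ i → ¬ Nonempty (bag i ∩ R))
  spine? R with least (λ i → nonempty? (bag i ∩ R)) | greatest (λ i → nonempty? (bag i ∩ R))
  ... | inj₂ none | _ = inj₂ none
  ... | inj₁ _ | inj₂ none = inj₂ none
  ... | inj₁ (a , (u , u∈aR) , first) | inj₁ (b , (v , v∈bR) , final) =
    inj₁ record { u = u ; v = v ; u∈R = proj₂ (x∈p∩q⁻ _ _ u∈aR) ; v∈R = proj₂ (x∈p∩q⁻ _ _ v∈bR)
                ; meets = meets }
    where
    meets : ∀ i → Nonempty (bag i ∩ R) → Σ (Fin n) λ q → q ∈ path u v × q ∈ₛ bag i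
    meets i ne with path u v | path-IsPath u v
    ... | _ ∷ _ | (l , _ , refl , e) =
      walk-meets-bags D l e (proj₁ (x∈p∩q⁻ _ _ u∈aR)) (proj₁ (x∈p∩q⁻ _ _ v∈bR)) (first i ne) (final i ne)

  level : ℕ → Subset n → Fin n → Strategy n
  level zero R w = done w
  level (suc j) R w with spine? R
  ... | inj₂ _ = done w
  ... | inj₁ sp = exitSearch w u λ x _ → exitSearch x v λ _ y → level j (region R (path w u ++ path x v) y) y
    where open Spine sp

  levelCost : ℕ → ℕ
  levelCost d = 2 * searchCost d

  record Invariant (t : Fin n) (d j : ℕ) (R : Subset n) (w : Fin n) : Set where
    field
      convex : Convex R
      w∈R : w ∈ₛ R
      t∈R : t ∈ₛ R
      narrow : ∀ i → ∣ bag i ∩ R ∣ ≤ suc j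
      near : length (path w t) ≤ suc d

  narrow⇒≡ : ∀ {R w t} → Convex R → w ∈ₛ R → t ∈ₛ R → (∀ i → ∣ bag i ∩ R ∣ ≤ 1) → w ≡ t
  narrow⇒≡ {R} {w} {t} convex w∈R t∈R narrow with path w t in wt≡ | path-IsPath w t
  ... | _ ∷ [] | (_ , _ , refl , refl) = refl
  ... | _ ∷ y ∷ _ | (w~y ∷ _ , w≢ ∷ _ , refl , _) with edges w y w~y
  ...   | i , w∈i , y∈i =
    ⊥-elim (<⇒≱ (x∈p∧y∈p∧x≢y⇒1<∣p∣ (x∈p∩q⁺ (w∈i , w∈R)) (x∈p∩q⁺ (y∈i , y∈R)) (All.head w≢)) (narrow i))
    where
    y∈R : y ∈ₛ R
    y∈R = convex w∈R t∈R (subst (y ∈_) (sym wt≡) (there (here refl)))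

  module Step {t d j R w} (I : Invariant t d (suc j) R w) (sp : Spine R) where

    open Invariant I
    open Spine sp
    module E₁ = Exit (exit w u t)
    x₁ : Fin n
    x₁ = E₁.fork
    module E₂ = Exit (exit x₁ v t)

    Q : List (Fin n)
    Q = path w u ++ path x₁ v

    x₁∈R : x₁ ∈ₛ R
    x₁∈R = convex w∈R u∈R (fork∈wa w u t)

    stem₁≤d : length E₁.stem ≤ d
    stem₁≤d = ≤-pred (≤-trans (stem<wt w u t) near)

    stem₂≤d : length E₂.stem ≤ d
    stem₂≤d = ≤-pred (≤-trans (stem<wt x₁ v t) (≤-trans (length-path-suffix (fork∈wt w u t)) near))

    Q⊆R : ∀ {q} → q ∈ Q → q ∈ₛ R
    Q⊆R q∈ with ∈-++⁻ (path w u) q∈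
    ... | inj₁ q∈wu = convex w∈R u∈R q∈wu
    ... | inj₂ q∈x₁v = convex x₁∈R v∈R q∈x₁v

    uv⊆Q : path u v ⊆ Q
    uv⊆Q q∈ with ∈-++⁻ (path x₁ u) (path-⊆-via x₁ q∈)
    ... | inj₁ q∈x₁u = ∈-++⁺ˡ (path-suffix (fork∈wa w u t) q∈x₁u)
    ... | inj₂ q∈x₁v = ∈-++⁺ʳ (path w u) q∈x₁v

    toT₂-avoids-Q : All (_∉ Q) E₂.toT
    toT₂-avoids-Q = All.tabulate avoid
      where
      avoid : ∀ {z} → z ∈ E₂.toT → z ∉ Q
      avoid z∈toT₂ z∈Q with ∈-++⁻ (path w u) z∈Q
      ... | inj₂ z∈x₁v = E₂.wa#toT (z∈x₁v , z∈toT₂)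
      ... | inj₁ z∈wu with subst (_ ∈_) (path-fork-t w u t) (toT⊆wt x₁ v t z∈toT₂)
      ...   | here refl = E₂.wa#toT (∈-path-start x₁ v , z∈toT₂)
      ...   | there z∈toT₁ = E₁.wa#toT (z∈wu , z∈toT₁)

    module _ {y} (answer : ValidAnswer G t E₂.fork (toward y)) where

      yt≡toT₂ : path y t ≡ E₂.toT
      yt≡toT₂ = answer-at-fork x₁ v t answer

      yt-avoids-Q : ∀ {z} → z ∈ path y t → All (_∉ Q) (path y z)
      yt-avoids-Q z∈ = All.tabulate λ q∈ → All.lookup toT₂-avoids-Q (subst (_ ∈_) yt≡toT₂ (path-prefix z∈ q∈))

      yt⊆wt : path y t ⊆ path w t
      yt⊆wt q∈ = path-suffix (fork∈wt w u t) (toT⊆wt x₁ v t (subst (_ ∈_) yt≡toT₂ q∈))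

      yt<wt : length (path y t) < length (path w t)
      yt<wt = begin-strict
        length (path y t)         <⟨ n<1+n _ ⟩
        suc (length (path y t))   ≡⟨ cong length (sym (answer-path answer)) ⟩
        length (path E₂.fork t)   ≤⟨ length-path-suffix (fork∈wt x₁ v t) ⟩
        length (path x₁ t)        ≤⟨ length-path-suffix (fork∈wt w u t) ⟩
        length (path w t)         ∎
        where open ≤-Reasoning

      next-invariant : Invariant t d j (region R Q y) y
      next-invariant = record
        { convex = region-convex convex
        ; w∈R = ∈-region⁺ (convex w∈R t∈R (yt⊆wt (∈-path-start y t))) (yt-avoids-Q (∈-path-start y t))
        ; t∈R = ∈-region⁺ t∈R (yt-avoids-Q (∈-path-end y t))
        ; narrow = λ i → region-narrower (bag i) (hit i) (narrow i)
        ; near = ≤-trans (<⇒≤ yt<wt) near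
        }
        where
        hit : ∀ i → Nonempty (bag i ∩ R) → Σ (Fin n) λ q → q ∈ Q × q ∈ₛ bag i ∩ R
        hit i ne = let q , q∈uv , q∈i = meets i ne in q , uv⊆Q q∈uv , x∈p∩q⁺ (q∈i , Q⊆R (uv⊆Q q∈uv))

  level-finds : ∀ {t d} j R w → Invariant t d j R w → FindsWithin G t (level j R w) (j * levelCost d)
  level-finds zero R w I =
    subst (λ x → FindsWithin G _ (done x) 0) (sym (narrow⇒≡ convex w∈R t∈R narrow)) done
    where open Invariant I
  level-finds {t} {d} (suc j) R w I with spine? R
  ... | inj₂ none = ⊥-elim (none (proj₁ (covers w)) (w , x∈p∩q⁺ (proj₂ (covers w) , Invariant.w∈R I)))
  ... | inj₁ sp = FindsWithin-mono (exitSearch-finds w u t k₁ λ _ → second) first≤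
    where
    open Spine sp
    open Step I sp
    k₂ : Fin n → Fin n → Strategy n
    k₂ _ y = level j (region R Q y) y
    k₁ : Fin n → Fin n → Strategy n
    k₁ x _ = exitSearch x v λ _ y → level j (region R (path w u ++ path x v) y) y
    second : FindsWithin G t (exitSearch x₁ v k₂) (searchCost d + j * levelCost d)
    second = FindsWithin-mono (exitSearch-finds x₁ v t k₂ λ answer → level-finds j _ _ (next-invariant answer))
                              (+-monoˡ-≤ _ (searchCost-mono stem₂≤d))
    first≤ : searchCost (length E₁.stem) + (searchCost d + j * levelCost d) ≤ suc j * levelCost d
    first≤ = ≤-trans (+-monoˡ-≤ _ (searchCost-mono stem₁≤d)) (≤-reflexive (two-searches (searchCost d) j))
      where
      two-searches : ∀ c j → c + (c + j * (2 * c)) ≡ suc j * (2 * c)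
      two-searches = solve-∀

  level-finds-from : ∀ s t d → Dist G s t d → FindsWithin G t (level k ⊤ s) (6 * suc k * suc ⌊log₂ d ⌋)
  level-finds-from s t d (p , P , len) = FindsWithin-mono (level-finds k ⊤ s invariant) cost≤
    where
    invariant : Invariant t d k ⊤ s
    invariant = record
      { convex = λ _ _ _ → ∈⊤ ; w∈R = ∈⊤ ; t∈R = ∈⊤
      ; narrow = λ i → subst (λ B → ∣ B ∣ ≤ suc k) (sym (∩-identityʳ (bag i))) (width≤ i)
      ; near = ≤-reflexive (trans (cong length (sym (≡path P))) len)
      }
    L : ℕ
    L = ⌊log₂ d ⌋
    cost≤ : k * levelCost d ≤ 6 * suc k * suc L
    cost≤ = begin
      k * (2 * (3 + 2 * L))         ≤⟨ *-mono-≤ (n≤1+n k) (subst (2 * (3 + 2 * L) ≤_) (slack L) (m≤m+n _ _)) ⟩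
      suc k * (6 * suc L)           ≡⟨ reorder k L ⟩
      6 * suc k * suc L             ∎
      where
      open ≤-Reasoning
      slack : ∀ L → 2 * (3 + 2 * L) + 2 * L ≡ 6 * suc L
      slack = solve-∀
      reorder : ∀ k L → suc k * (6 * suc L) ≡ 6 * suc k * suc L
      reorder = solve-∀

-- Choosing the best strategy of bounded depth

∃-length? : ∀ {n} {P : List (Fin n) → Set} → (∀ xs → Dec (P xs)) →
            ∀ L → Dec (∃ λ xs → length xs ≡ L × P xs)
∃-length? P? zero = map′ (λ p → [] , refl , p) (λ { ([] , _ , p) → p }) (P? [])
∃-length? P? (suc L) =
  map′ (λ { (x , xs , len , p) → x ∷ xs , cong suc len , p })
       (λ { (x ∷ xs , len , p) → x , xs , suc-injective len , p })
       (Fin.any? λ x → ∃-length? (P? ∘ (x ∷_)) L)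

∃-bounded? : ∀ {n} {P : List (Fin n) → Set} → (∀ xs → Dec (P xs)) →
             ∀ N → (∀ {xs} → P xs → length xs ≤ N) → Dec (∃ P)
∃-bounded? P? N bound =
  map′ (λ { (_ , _ , xs , _ , p) → xs , p })
       (λ { (xs , p) → length xs , s≤s (bound p) , xs , refl , p })
       (anyUpTo? (∃-length? P?) (suc N))

module Deciding {n : ℕ} (G : Graph n) where

  open import Data.List.Relation.Unary.Unique.DecPropositional (_≟_ {n}) using (unique?)

  IsPath? : ∀ u v p → Dec (IsPath G u v p)
  IsPath? u v p = linked? (λ a b → G a b Bool.≟ true) p ×-dec unique? p
                  ×-dec Maybe.≡-dec _≟_ (head p) (just u) ×-dec Maybe.≡-dec _≟_ (last p) (just v)

  ValidAnswer? : ∀ t x r → Dec (ValidAnswer G t x r)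
  ValidAnswer? t x here = map′ (λ { refl → found }) (λ { found → refl }) (x ≟ t)
  ValidAnswer? t x (toward y) with x ≟ t
  ... | yes refl = no λ { (step x≢x _) → x≢x refl }
  ... | no x≢t = map′ (step x≢t) (λ { (step _ e) → e })
                      (∃-bounded? (λ rest → IsPath? x t (x ∷ y ∷ rest)) n
                                  (λ P → ≤-trans (n≤1+n _) (≤-trans (n≤1+n _) (IsPath-length≤ P))))

  Dist? : ∀ s t d → Dec (Dist G s t d)
  Dist? s t d = ∃-bounded? (λ p → IsPath? s t p ×-dec length p ℕ.≟ suc d) n (IsPath-length≤ ∘ proj₁)

  ∀-response? : {P : Response n → Set} → (∀ r → Dec (P r)) → Dec (∀ r → P r)
  ∀-response? P? = map′ (λ { (p-here , p-toward) here → p-here ; (_ , p-toward) (toward y) → p-toward y })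
                        (λ p → p here , p ∘ toward) (P? here ×-dec Fin.all? (P? ∘ toward))

  FindsWithin? : ∀ t σ q → Dec (FindsWithin G t σ q)
  FindsWithin? t (done x) q = map′ (λ { refl → done }) (λ { done → refl }) (x ≟ t)
  FindsWithin? t (query x f) zero = no λ ()
  FindsWithin? t (query x f) (suc q) =
    map′ query (λ { (query next) → next }) (∀-response? λ r → ValidAnswer? t x r →-dec FindsWithin? t (f r) q)

tables : ∀ {A : Set} L → List A → List (Vec A L)
tables zero xs = [ Vec.[] ]
tables (suc L) xs = List.concatMap (λ a → List.map (a Vec.∷_) (tables L xs)) xs

tables-complete : ∀ {A : Set} {L} xs (v : Vec A L) → (∀ i → Vec.lookup v i ∈ xs) → v ∈ tables L xs
tables-complete xs Vec.[] _ = here refl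
tables-complete {L = suc L} xs (a Vec.∷ v) v⊆ =
  ∈-concatMap⁺ (λ a → List.map (a Vec.∷_) (tables L xs))
    (Any.map (λ { refl → ∈-map⁺ (a Vec.∷_) (tables-complete xs v (v⊆ ∘ Fin.suc)) }) (v⊆ Fin.zero))

module _ {n : ℕ} where

  index : Response n → Fin (suc n)
  index here = Fin.zero
  index (toward y) = Fin.suc y

  strategies : ℕ → List (Strategy n)
  strategies zero = List.map done (List.allFin n)
  strategies (suc D) = List.map done (List.allFin n) ++ List.concatMap queries (List.allFin n)
    where
    queries : Fin n → List (Strategy n)
    queries x = List.map (λ v → query x (Vec.lookup v ∘ index)) (tables (suc n) (strategies D))

  done∈strategies : ∀ D x → done x ∈ strategies D
  done∈strategies zero x = ∈-map⁺ done (∈-allFin x)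
  done∈strategies (suc D) x = ∈-++⁺ˡ (∈-map⁺ done (∈-allFin x))

  truncation : ∀ D σ → Σ (Strategy n) λ σ′ → σ′ ∈ strategies D ×
               (∀ {G t q} → q ≤ D → FindsWithin G t σ q → FindsWithin G t σ′ q)
  truncation D (done x) = done x , done∈strategies D x , λ _ f → f
  truncation zero (query x f) = done x , done∈strategies zero x , λ { z≤n () }
  truncation (suc D) (query x f) = query x (Vec.lookup table ∘ index) , table∈ , transfer
    where
    row : Response n → Strategy n
    row r = proj₁ (truncation D (f r))
    row′ : Fin (suc n) → Strategy n
    row′ Fin.zero = row here
    row′ (Fin.suc y) = row (toward y)
    table : Vec (Strategy n) (suc n)
    table = Vec.tabulate row′
    lookup-table : ∀ r → Vec.lookup table (index r) ≡ row r
    lookup-table here = refl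
    lookup-table (toward y) = lookup∘tabulate row′ (Fin.suc y)
    table∈ : query x (Vec.lookup table ∘ index) ∈ strategies (suc D)
    table∈ = ∈-++⁺ʳ (List.map done (List.allFin n)) (∈-concatMap⁺ _ (Any.map (λ { refl → ∈-map⁺ _
               (tables-complete _ table row∈) }) (∈-allFin x)))
      where
      row∈ : ∀ i → Vec.lookup table i ∈ strategies D
      row∈ Fin.zero = proj₁ (proj₂ (truncation D (f here)))
      row∈ (Fin.suc y) = subst (_∈ strategies D) (sym (lookup∘tabulate row′ (Fin.suc y)))
                                (proj₁ (proj₂ (truncation D (f (toward y)))))
    transfer : ∀ {G t q} → q ≤ suc D → FindsWithin G t (query x f) q →
               FindsWithin G t (query x (Vec.lookup table ∘ index)) q
    transfer {G} {t} (s≤s q≤D) (query next) = query λ r v →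
      subst (λ σ → FindsWithin G t σ _) (sym (lookup-table r)) (proj₂ (proj₂ (truncation D (f r))) q≤D (next r v))

-- Large enough for the rate 6 (k + 1) of the level strategy, as the pathwidth k is at most n.
maxRate : ℕ → ℕ
maxRate n = 6 * suc n

maxDepth : ℕ → ℕ
maxDepth n = maxRate n * suc ⌊log₂ n ⌋

-- The restriction d < n, automatic for distances, makes the guarantee decidable.
Guarantee : ∀ {n} → Graph n → Fin n → ℕ → Strategy n → Set
Guarantee {n} G s R σ = ∀ t {d} → d < n → Dist G s t d → FindsWithin G t σ (R * suc ⌊log₂ d ⌋)

Guarantee? : ∀ {n} (G : Graph n) s R σ → Dec (Guarantee G s R σ)
Guarantee? {n} G s R σ =
  Fin.all? λ t → allUpTo? (λ d → Dist? s t d →-dec FindsWithin? t σ (R * suc ⌊log₂ d ⌋)) n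
  where open Deciding G

achievable? : ∀ {n} (G : Graph n) s (R : Fin (suc (maxRate n))) →
              Dec (Any (Guarantee G s (Fin.toℕ R)) (strategies (maxDepth n)))
achievable? {n} G s R = Any.any? (Guarantee? G s (Fin.toℕ R)) (strategies (maxDepth n))

best : ∀ {n} → Graph n → Fin n → Strategy n
best {n} G s with least (achievable? G s)
... | inj₁ (_ , good , _) = proj₁ (Any.satisfied good)
... | inj₂ _ = done s

best-guarantee : ∀ {n} (G : Graph n) s R → R ≤ maxRate n →
                 (Σ (Strategy n) λ σ → σ ∈ strategies (maxDepth n) × Guarantee G s R σ) →
                 Σ ℕ λ R′ → R′ ≤ R × Guarantee G s R′ (best G s)
best-guarantee {n} G s R R≤ (σ , σ∈ , g) = choose (Any.map (λ { refl → g′ }) σ∈)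
  where
  R̂ : Fin (suc (maxRate n))
  R̂ = Fin.fromℕ< (s≤s R≤)
  g′ : Guarantee G s (Fin.toℕ R̂) σ
  g′ = subst (λ R → Guarantee G s R σ) (sym (Fin.toℕ-fromℕ< (s≤s R≤))) g
  choose : Any (Guarantee G s (Fin.toℕ R̂)) (strategies (maxDepth n)) →
           Σ ℕ λ R′ → R′ ≤ R × Guarantee G s R′ (best G s)
  choose R̂-good with least (achievable? G s)
  ... | inj₁ (i , good , minimal) = Fin.toℕ i , subst (Fin.toℕ i ≤_) (Fin.toℕ-fromℕ< (s≤s R≤)) (minimal R̂ R̂-good)
                                   , proj₂ (Any.satisfied good)
  ... | inj₂ none = ⊥-elim (none R̂ R̂-good)

theorem2 : Σ ℕ λ C → Σ (∀ {n} → Graph n → Fin n → Strategy n) λ alg →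
    ∀ (n : ℕ) (G : Graph n) → IsTree G → (k : ℕ) → Pathwidth G k →
    (s t : Fin n) (d : ℕ) → Dist G s t d →
    FindsWithin G t (alg G s) (C * suc k * suc ⌊log₂ d ⌋)
theorem2 = 6 , best , best-finds
  where
  best-finds : ∀ n (G : Graph n) → IsTree G → ∀ k → Pathwidth G k → ∀ s t d → Dist G s t d →
               FindsWithin G t (best G s) (6 * suc k * suc ⌊log₂ d ⌋)
  best-finds n G T k pw@(D , _) s t d dist =
    let R′ , R′≤ , guarantee = best-guarantee G s (6 * suc k) rate≤ candidate
    in FindsWithin-mono (guarantee t (Dist⇒< dist) dist) (*-monoˡ-≤ _ R′≤)
    where
    rate≤ : 6 * suc k ≤ maxRate n
    rate≤ = *-monoʳ-≤ 6 (s≤s (pathwidth≤n pw))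
    candidate : Σ (Strategy n) λ σ → σ ∈ strategies (maxDepth n) × Guarantee G s (6 * suc k) σ
    candidate = let σ , σ∈ , transfer = truncation (maxDepth n) (Levels.level T D k ⊤ s) in
      σ , σ∈ , λ t′ d′<n dist′ → transfer (*-mono-≤ rate≤ (s≤s (⌊log₂⌋-mono-≤ (<⇒≤ d′<n))))
                                          (Levels.level-finds-from T D s t′ _ dist′)
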